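{- Let $w$ be a 2D word of size $(m,n)$. Then $0\le|HVPALConj(w)|\le 4$ if $m$ and $n$ are both even, $0\le|HVPALConj(w)|\le 1$ if $m$ and $n$ are both odd, and $0\le|HVPALConj(w)|\le 2$ otherwise.
   Context: A 2D word of size $(m,n)$ over a finite alphabet is an $m\times n$ array $w$ with rows $u_1,\dots,u_m$ and columns $v_1,\dots,v_n$ (each a 1D word). A 1D word is a palindrome if it equals its reversal; $w$ is an HV-palindrome if each of its rows and each of its columns is a 1D palindrome. For $1\le k\le n$, $\circlearrowleft^{Col}_k w$ is the word whose columns are, in order, $v_{n-k+1},\dots,v_n,v_1,\dots,v_{n-k}$; for $1\le k\le m$, $\circlearrowleft^{Row}_k w$ is the word whose rows are, in order, $u_{m-k+1},\dots,u_m,u_1,\dots,u_{m-k}$. The conjugacy class of $w$ is $Conj(w)=\{\circlearrowleft^{Col}_i\circlearrowleft^{Row}_j w : 1\le i\le n,\ 1\le j\le m\}$, and $HVPALConj(w)$ is the set of elements of $Conj(w)$ that are HV-palindromes. -}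

module Defs where

open import Data.Nat using (ℕ; zero; suc)
open import Data.Fin using (Fin)
open import Data.Fin.Properties using () renaming (_≟_ to _≟F_)
open import Data.Vec using (Vec; []; _∷_; map; reverse; transpose; init; last)
open import Data.Vec.Properties using (≡-dec)
open import Data.Vec.Relation.Unary.All using (All; all?)
open import Data.List using (List; concatMap; upTo; filter; deduplicate; length)
import Data.List as L
open import Data.Product using (_×_)
open import Relation.Binary.PropositionalEquality using (_≡_)
open import Relation.Nullary using (Dec)
open import Relation.Nullary.Decidable using (_×-dec_)
open import Relation.Binary.Definitions using (DecidableEquality)

Word : ℕ → ℕ → ℕ → Set
Word k m n = Vec (Vec (Fin k) n) m

IsPal : ∀ {A : Set} {n} → Vec A n → Set
IsPal v = reverse v ≡ v

IsHVPal : ∀ {k m n} → Word k m n → Set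
IsHVPal w = All IsPal w × All IsPal (transpose w)

rot1 : ∀ {A : Set} {n} → Vec A n → Vec A n
rot1 [] = []
rot1 (x ∷ xs) = last (x ∷ xs) ∷ init (x ∷ xs)

rotR : ∀ {A : Set} {n} → ℕ → Vec A n → Vec A n
rotR zero v = v
rotR (suc j) v = rot1 (rotR j v)

-- ↺^Col_i : columns become v_{n-i+1},...,v_n,v_1,...,v_{n-i}
rotCol : ∀ {k m n} → ℕ → Word k m n → Word k m n
rotCol i w = map (rotR i) w

rotRow : ∀ {k m n} → ℕ → Word k m n → Word k m n
rotRow j w = rotR j w

_≟W_ : ∀ {k m n} → DecidableEquality (Word k m n)
_≟W_ = ≡-dec (≡-dec _≟F_)

isPal? : ∀ {k n} (v : Vec (Fin k) n) → Dec (IsPal v)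
isPal? v = ≡-dec _≟F_ (reverse v) v

isHVPal? : ∀ {k m n} (w : Word k m n) → Dec (IsHVPal w)
isHVPal? w = all? isPal? w ×-dec all? isPal? (transpose w)

-- Conj(w) as a list (with possible repetitions) of
-- ↺^Col_i ↺^Row_j w for 1 ≤ i ≤ n, 1 ≤ j ≤ m.
conjList : ∀ {k m n} → Word k m n → List (Word k m n)
conjList {m = m} {n = n} w =
  concatMap (λ i → L.map (λ j → rotCol (suc i) (rotRow (suc j) w)) (upTo m)) (upTo n)

hvpalConj : ∀ {k m n} → Word k m n → List (Word k m n)
hvpalConj w = deduplicate _≟W_ (filter isHVPal? (conjList w))

card-HVPALConj : ∀ {k m n} → Word k m n → ℕ
card-HVPALConj w = length (hvpalConj w)

-- Fix one HV-palindromic conjugate W; every other conjugate is W shifted by p columns and q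
-- rows.  Reversing every row turns a column shift into its inverse, so if the shifted word is
-- again an HV-palindrome, shifting W by 2p columns fixes it; likewise 2q rows fix W (reversing
-- the order of the rows).  If d is the least column period of W, then p ≡ 0 or p ≡ d/2 modulo
-- d, and the second case needs d, hence n, to be even.  So at most 2 column shifts (1 when n is
-- odd) and at most 2 row shifts (1 when m is odd) can occur, which gives the bounds 4, 2 and 1.
module Submission where

open import Defs
open import Data.Nat using (ℕ; zero; suc; _+_; _*_; _≤_; _<_; z≤n; s≤s; _/_; _%_)
open import Data.Nat.Properties
open import Data.Nat.DivMod using (m≡m%n+[m/n]*n; m%n<n; %-distribˡ-+; m*n/n≡m)
open import Data.Nat.Divisibility using (_∣_; _∣?_; divides; ∣-trans; m%n≡0⇒n∣m; n∣m⇒m%n≡0)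
open import Data.Fin using (Fin; toℕ; fromℕ; fromℕ<; inject)
open import Data.Fin.Properties using (¬∀⟶∃¬-smallest; toℕ-fromℕ; toℕ-fromℕ<; toℕ-inject)
open import Data.Vec using (Vec; []; _∷_; map; reverse; transpose; lookup; replicate; _⊛_; _∷ʳ_; initLast; toList)
open import Data.Vec.Properties
  using (init-∷ʳ; last-∷ʳ; map-∷ʳ; reverse-∷; reverse-reverse; reverse-involutive; map-∘; map-cong;
         map-id; map-reverse; ∷-injectiveˡ; ∷-injectiveʳ; lookup-⊛; lookup-replicate; toList-∷ʳ;
         toList-injective; cast-is-id; length-toList)
open import Data.Vec.Relation.Unary.All using (All; []; _∷_)
open import Data.Vec.Relation.Unary.All.Properties using (lookup⁺)
open import Data.Vec.Relation.Binary.Pointwise.Extensional using (ext; Pointwise-≡⇒≡)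
open import Data.List as List using (List; []; _∷_; _++_; length; cartesianProductWith; upTo; filter)
open import Data.List.Properties using (++-assoc; ++-identityʳ; length-++; length-map)
open import Data.List.Membership.Propositional using (_∈_)
open import Data.List.Membership.Propositional.Properties
  using (∈-map⁻; ∈-concatMap⁻; ∈-filter⁻; ∈-deduplicate⁻; ∈-cartesianProductWith⁺)
open import Data.List.Relation.Unary.Any using (here; there; satisfied)
import Data.List.Relation.Unary.All as ListAll
open import Data.List.Relation.Unary.AllPairs using (_∷_)
open import Data.List.Relation.Unary.Unique.Propositional using (Unique)
open import Data.List.Relation.Unary.Unique.DecPropositional.Properties using (deduplicate-!)
open import Data.List.Relation.Binary.Subset.Propositional using (_⊆_)
open import Data.Product using (∃; ∃₂; ∃-syntax; _×_; _,_; proj₁; proj₂)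
open import Data.Sum using (_⊎_; inj₁; inj₂)
open import Relation.Nullary using (¬_; yes; no; ¬?; contradiction)
open import Relation.Nullary.Decidable using (decidable-stable)
open import Function using (_$_)
open import Relation.Binary.Definitions using (DecidableEquality)
open import Relation.Binary.PropositionalEquality
open ≡-Reasoning


module _ {A : Set} where

  rot1-∷ʳ : ∀ {n} (xs : Vec A n) x → rot1 (xs ∷ʳ x) ≡ x ∷ xs
  rot1-∷ʳ []       x = refl
  rot1-∷ʳ (y ∷ ys) x = cong₂ _∷_ (last-∷ʳ x (y ∷ ys)) (init-∷ʳ x (y ∷ ys))

  reverse-∷ʳ : ∀ {n} (xs : Vec A n) x → reverse (xs ∷ʳ x) ≡ x ∷ reverse xs
  reverse-∷ʳ xs x =
    reverse-reverse (trans (reverse-∷ x (reverse xs)) (cong (_∷ʳ x) (reverse-involutive xs)))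

  rotL : ∀ {n} → Vec A n → Vec A n
  rotL []       = []
  rotL (x ∷ xs) = xs ∷ʳ x

  rotL^ : ∀ {n} → ℕ → Vec A n → Vec A n
  rotL^ zero    v = v
  rotL^ (suc k) v = rotL^ k (rotL v)

  rot1-rotL : ∀ {n} (v : Vec A n) → rot1 (rotL v) ≡ v
  rot1-rotL []       = refl
  rot1-rotL (x ∷ xs) = rot1-∷ʳ xs x

  rotR-rotL^ : ∀ {n} k (v : Vec A n) → rotR k (rotL^ k v) ≡ v
  rotR-rotL^ zero    v = refl
  rotR-rotL^ (suc k) v = trans (cong rot1 (rotR-rotL^ k (rotL v))) (rot1-rotL v)

  rotR-+ : ∀ {n} a b (v : Vec A n) → rotR a (rotR b v) ≡ rotR (a + b) v
  rotR-+ zero    b v = refl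
  rotR-+ (suc a) b v = cong rot1 (rotR-+ a b v)

  -- rotL^-length passes through lists, where the intermediate stages xs ++ ys ↦ ys ++ xs can be
  -- stated without casts between the lengths m + n and n + m.
  rotLList : List A → List A
  rotLList []       = []
  rotLList (x ∷ xs) = xs ++ List.[ x ]

  rotLList^ : ℕ → List A → List A
  rotLList^ zero    xs = xs
  rotLList^ (suc k) xs = rotLList^ k (rotLList xs)

  rotLList^-++ : ∀ xs ys → rotLList^ (length xs) (xs ++ ys) ≡ ys ++ xs
  rotLList^-++ []       ys = sym (++-identityʳ ys)
  rotLList^-++ (x ∷ xs) ys = begin
    rotLList^ (length xs) ((xs ++ ys) ++ List.[ x ]) ≡⟨ cong (rotLList^ (length xs)) (++-assoc xs ys _) ⟩
    rotLList^ (length xs) (xs ++ ys ++ List.[ x ])   ≡⟨ rotLList^-++ xs (ys ++ List.[ x ]) ⟩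
    (ys ++ List.[ x ]) ++ xs                         ≡⟨ ++-assoc ys List.[ x ] xs ⟩
    ys ++ x ∷ xs                                     ∎

  toList-rotL^ : ∀ {n} k (v : Vec A n) → toList (rotL^ k v) ≡ rotLList^ k (toList v)
  toList-rotL^ zero    v        = refl
  toList-rotL^ (suc k) []       = toList-rotL^ k []
  toList-rotL^ (suc k) (x ∷ xs) =
    trans (toList-rotL^ k (xs ∷ʳ x)) (cong (rotLList^ k) (toList-∷ʳ x xs))

  rotL^-length : ∀ {n} (v : Vec A n) → rotL^ n v ≡ v
  rotL^-length {n} v = trans (sym (cast-is-id refl (rotL^ n v))) (toList-injective refl _ _ (begin
    toList (rotL^ n v)                             ≡⟨ toList-rotL^ n v ⟩
    rotLList^ n (toList v)                         ≡⟨ cong (λ k → rotLList^ k (toList v)) (length-toList v) ⟨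
    rotLList^ (length (toList v)) (toList v)       ≡⟨ cong (rotLList^ (length (toList v))) (++-identityʳ (toList v)) ⟨
    rotLList^ (length (toList v)) (toList v ++ []) ≡⟨ rotLList^-++ (toList v) [] ⟩
    toList v                                       ∎))

  rotR-length : ∀ {n} (v : Vec A n) → rotR n v ≡ v
  rotR-length {n} v = trans (cong (rotR n) (sym (rotL^-length v))) (rotR-rotL^ n v)

  rotL≡rotR : ∀ {n} (v : Vec A (suc n)) → rotL v ≡ rotR n v
  rotL≡rotR {n} v = begin
    rotL v                 ≡⟨ rotR-length (rotL v) ⟨
    rotR (suc n) (rotL v)  ≡⟨ cong (λ k → rotR k (rotL v)) (+-comm 1 n) ⟩
    rotR (n + 1) (rotL v)  ≡⟨ rotR-+ n 1 (rotL v) ⟨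
    rotR n (rot1 (rotL v)) ≡⟨ cong (rotR n) (rot1-rotL v) ⟩
    rotR n v               ∎

  reverse-rot1 : ∀ {n} (v : Vec A n) → reverse (rot1 v) ≡ rotL (reverse v)
  reverse-rot1 {zero}  [] = refl
  reverse-rot1 {suc n} v with initLast v
  ... | xs , x , refl = begin
    reverse (rot1 (xs ∷ʳ x)) ≡⟨ cong reverse (rot1-∷ʳ xs x) ⟩
    reverse (x ∷ xs)         ≡⟨ reverse-∷ x xs ⟩
    rotL (x ∷ reverse xs)    ≡⟨ cong rotL (reverse-∷ʳ xs x) ⟨
    rotL (reverse (xs ∷ʳ x)) ∎

  -- a * n is -a modulo the length suc n.
  reverse-rotR : ∀ {n} a (v : Vec A (suc n)) → reverse (rotR a v) ≡ rotR (a * n) (reverse v)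
  reverse-rotR         zero    v = refl
  reverse-rotR {n = n} (suc a) v = begin
    reverse (rot1 (rotR a v))         ≡⟨ reverse-rot1 (rotR a v) ⟩
    rotL (reverse (rotR a v))         ≡⟨ cong rotL (reverse-rotR a v) ⟩
    rotL (rotR (a * n) (reverse v))   ≡⟨ rotL≡rotR _ ⟩
    rotR n (rotR (a * n) (reverse v)) ≡⟨ rotR-+ n (a * n) _ ⟩
    rotR (n + a * n) (reverse v)      ∎

module _ {A B : Set} (f : A → B) where

  map-rot1 : ∀ {n} (v : Vec A n) → map f (rot1 v) ≡ rot1 (map f v)
  map-rot1 {zero}  [] = refl
  map-rot1 {suc n} v with initLast v
  ... | xs , x , refl = begin
    map f (rot1 (xs ∷ʳ x)) ≡⟨ cong (map f) (rot1-∷ʳ xs x) ⟩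
    f x ∷ map f xs         ≡⟨ rot1-∷ʳ (map f xs) (f x) ⟨
    rot1 (map f xs ∷ʳ f x) ≡⟨ cong rot1 (map-∷ʳ f x xs) ⟨
    rot1 (map f (xs ∷ʳ x)) ∎

  map-rotR : ∀ {n} a (v : Vec A n) → map f (rotR a v) ≡ rotR a (map f v)
  map-rotR zero    v = refl
  map-rotR (suc a) v = trans (map-rot1 (rotR a v)) (cong rot1 (map-rotR a v))

record CyclicAction (X : Set) (n : ℕ) : Set where
  field
    act        : ℕ → X → X
    act-+      : ∀ a b x → act a (act b x) ≡ act (a + b) x
    act-zero   : ∀ x → act 0 x ≡ x
    act-period : ∀ x → act (suc n) x ≡ x

  fixed-*ˡ : ∀ {d x} q → act d x ≡ x → act (q * d) x ≡ x
  fixed-*ˡ {d} {x} zero    fixed = act-zero x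
  fixed-*ˡ {d} {x} (suc q) fixed = begin
    act (d + q * d) x     ≡⟨ act-+ d (q * d) x ⟨
    act d (act (q * d) x) ≡⟨ cong (act d) (fixed-*ˡ q fixed) ⟩
    act d x               ≡⟨ fixed ⟩
    x                     ∎

  act-comm : ∀ a b x → act a (act b x) ≡ act b (act a x)
  act-comm a b x = begin
    act a (act b x) ≡⟨ act-+ a b x ⟩
    act (a + b) x   ≡⟨ cong (λ c → act c x) (+-comm a b) ⟩
    act (b + a) x   ≡⟨ act-+ b a x ⟨
    act b (act a x) ∎

  act-inverseʳ : ∀ a x → act a (act (a * n) x) ≡ x
  act-inverseʳ a x = begin
    act a (act (a * n) x) ≡⟨ act-+ a (a * n) x ⟩
    act (a + a * n) x     ≡⟨ cong (λ c → act c x) (*-suc a n) ⟨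
    act (a * suc n) x     ≡⟨ fixed-*ˡ a (act-period x) ⟩
    x                     ∎

  act-inverseˡ : ∀ a x → act (a * n) (act a x) ≡ x
  act-inverseˡ a x = trans (act-comm (a * n) a x) (act-inverseʳ a x)

open CyclicAction using (act)

rotR-action : ∀ {A : Set} {n} → CyclicAction (Vec A (suc n)) n
rotR-action = record
  { act        = rotR
  ; act-+      = rotR-+
  ; act-zero   = λ _ → refl
  ; act-period = rotR-length
  }

map-action : ∀ {X : Set} {m n} → CyclicAction X n → CyclicAction (Vec X m) n
map-action T = record
  { act        = λ a → map (act T a)
  ; act-+      = λ a b xs → trans (sym (map-∘ (act T a) (act T b) xs)) (map-cong (T.act-+ a b) xs)
  ; act-zero   = λ xs → trans (map-cong T.act-zero xs) (map-id xs)
  ; act-period = λ xs → trans (map-cong T.act-period xs) (map-id xs)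
  }
  where module T = CyclicAction T

module _ {X : Set} {m n} (T : CyclicAction X n) (U : CyclicAction X m)
         (T-U : ∀ a b x → act T a (act U b x) ≡ act U b (act T a x))
         (S : X → X)
         (S-T : ∀ a x → S (act T a x) ≡ act T (a * n) (S x))
         (S-U : ∀ b x → S (act U b x) ≡ act U b (S x)) where

  private
    module T = CyclicAction T
    module U = CyclicAction U

  symmetric-translate⇒double-period : ∀ {x} p q → S x ≡ x →
    S (act T p (act U q x)) ≡ act T p (act U q x) → act T (p + p) x ≡ x
  symmetric-translate⇒double-period {x} p q Sx Sy = begin
    act T (p + p) x                 ≡⟨ cong (act T (p + p)) (U.act-inverseˡ q x) ⟨
    act T (p + p) (act U (q * m) y) ≡⟨ T-U (p + p) (q * m) y ⟩
    act U (q * m) (act T (p + p) y) ≡⟨ cong (act U (q * m)) y-double ⟩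
    act U (q * m) y                 ≡⟨ U.act-inverseˡ q x ⟩
    x                               ∎
    where
    y = act U q x
    Sy≡y : S y ≡ y
    Sy≡y = trans (S-U q x) (cong (act U q) Sx)
    Ty≡T⁻¹y : act T p y ≡ act T (p * n) y
    Ty≡T⁻¹y = begin
      act T p y           ≡⟨ Sy ⟨
      S (act T p y)       ≡⟨ S-T p y ⟩
      act T (p * n) (S y) ≡⟨ cong (act T (p * n)) Sy≡y ⟩
      act T (p * n) y     ∎
    y-double : act T (p + p) y ≡ y
    y-double = begin
      act T (p + p) y           ≡⟨ T.act-+ p p y ⟨
      act T p (act T p y)       ≡⟨ cong (act T p) Ty≡T⁻¹y ⟩
      act T p (act T (p * n) y) ≡⟨ T.act-inverseʳ p y ⟩
      y                         ∎

parityBound : ℕ → ℕ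
parityBound n with 2 ∣? n
... | yes _ = 2
... | no  _ = 1

parityBound-even : ∀ {n} → 2 ∣ n → parityBound n ≡ 2
parityBound-even {n} even with 2 ∣? n
... | yes _   = refl
... | no  odd = contradiction even odd

parityBound-odd : ∀ {n} → ¬ 2 ∣ n → parityBound n ≡ 1
parityBound-odd {n} odd with 2 ∣? n
... | yes even = contradiction even odd
... | no  _    = refl

1≤parityBound : ∀ n → 1 ≤ parityBound n
1≤parityBound n with 2 ∣? n
... | yes _ = s≤s z≤n
... | no  _ = s≤s z≤n

m+m≡m*2 : ∀ m → m + m ≡ m * 2
m+m≡m*2 m = trans (cong (m +_) (sym (*-identityʳ m))) (sym (*-suc m 1))

n∣m+m⇒m≡0⊎m+m≡n : ∀ {n m} → n ∣ m + m → m < n → m ≡ 0 ⊎ m + m ≡ n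
n∣m+m⇒m≡0⊎m+m≡n {n} {m} (divides zero          m+m≡0)   _   = inj₁ (m+n≡0⇒m≡0 m m+m≡0)
n∣m+m⇒m≡0⊎m+m≡n {n} {m} (divides (suc zero)    m+m≡n)   _   = inj₂ (trans m+m≡n (+-identityʳ n))
n∣m+m⇒m≡0⊎m+m≡n {n} {m} (divides (suc (suc k)) m+m≡kn) m<n =
  contradiction (+-mono-< m<n m<n)
    (≤⇒≯ (subst (n + n ≤_) (sym m+m≡kn) (+-monoʳ-≤ n (m≤m+n n (k * n)))))

module HalfPeriods {X : Set} {n} (T : CyclicAction X n) (_≟_ : DecidableEquality X) (x : X) where

  open CyclicAction T hiding (act)

  private
    Aperiodic : Fin (suc n) → Set
    Aperiodic i = act T (suc (toℕ i)) x ≢ x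

    least : ∃ λ i → ¬ Aperiodic i × (∀ j → Aperiodic (inject {i = i} j))
    least = ¬∀⟶∃¬-smallest (suc n) Aperiodic (λ i → ¬? (act T (suc (toℕ i)) x ≟ x))
      (λ aperiodic → aperiodic (fromℕ n)
        (subst (λ t → act T (suc t) x ≡ x) (sym (toℕ-fromℕ n)) (act-period x)))

  period : ℕ
  period = suc (toℕ (proj₁ least))

  period-fixes : act T period x ≡ x
  period-fixes = decidable-stable (act T period x ≟ x) (proj₁ (proj₂ least))

  period-least : ∀ r → suc r < period → act T (suc r) x ≢ x
  period-least r (s≤s r<i) = subst (λ t → act T (suc t) x ≢ x) toℕ-j (proj₂ (proj₂ least) j)
    where
    j = fromℕ< r<i
    toℕ-j : toℕ (inject j) ≡ r
    toℕ-j = trans (toℕ-inject j) (toℕ-fromℕ< r<i)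

  act-%-period : ∀ a → act T a x ≡ act T (a % period) x
  act-%-period a = begin
    act T a x                                          ≡⟨ cong (λ c → act T c x) (m≡m%n+[m/n]*n a period) ⟩
    act T (a % period + a / period * period) x         ≡⟨ act-+ (a % period) _ x ⟨
    act T (a % period) (act T (a / period * period) x) ≡⟨ cong (act T (a % period)) (fixed-*ˡ (a / period) period-fixes) ⟩
    act T (a % period) x                               ∎

  period-∣ : ∀ t → act T t x ≡ x → period ∣ t
  period-∣ t fixed = m%n≡0⇒n∣m t period (residue-zero (t % period) refl)
    where
    residue-zero : ∀ r → t % period ≡ r → r ≡ 0
    residue-zero zero    _  = refl
    residue-zero (suc r) eq = contradiction
      (trans (sym (cong (λ c → act T c x) eq)) (trans (sym (act-%-period t)) fixed))
      (period-least r (subst (_< period) eq (m%n<n t period)))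

  halfPeriods : List ℕ
  halfPeriods with 2 ∣? suc n
  ... | yes _ = 0 ∷ period / 2 ∷ []
  ... | no  _ = 0 ∷ []

  length-halfPeriods : length halfPeriods ≡ parityBound (suc n)
  length-halfPeriods with 2 ∣? suc n
  ... | yes _ = refl
  ... | no  _ = refl

  0∈halfPeriods : 0 ∈ halfPeriods
  0∈halfPeriods with 2 ∣? suc n
  ... | yes _ = here refl
  ... | no  _ = here refl

  halfPeriods-complete : ∀ p → act T (p + p) x ≡ x → ∃[ e ] e ∈ halfPeriods × act T p x ≡ act T e x
  halfPeriods-complete p fixed with n∣m+m⇒m≡0⊎m+m≡n period-∣r+r (m%n<n p period)
    where
    period-∣r+r : period ∣ p % period + p % period
    period-∣r+r = m%n≡0⇒n∣m _ period
      (trans (sym (%-distribˡ-+ p p period)) (n∣m⇒m%n≡0 (p + p) period (period-∣ (p + p) fixed)))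
  ... | inj₁ r≡0 = 0 , 0∈halfPeriods , trans (act-%-period p) (cong (λ c → act T c x) r≡0)
  ... | inj₂ r+r≡period with 2 ∣? suc n
  ...   | yes _ = period / 2 , there (here refl) , trans (act-%-period p) (cong (λ c → act T c x) r≡half)
    where
    r≡half : p % period ≡ period / 2
    r≡half = sym (trans (cong (_/ 2) (trans (sym r+r≡period) (m+m≡m*2 (p % period))))
                        (m*n/n≡m (p % period) 2))
  ...   | no odd = contradiction (∣-trans 2∣period (period-∣ (suc n) (act-period x))) odd
    where
    2∣period : 2 ∣ period
    2∣period = divides (p % period) (trans (sym r+r≡period) (m+m≡m*2 (p % period)))

module _ {A : Set} where

  lookup-transpose : ∀ {m n} (xss : Vec (Vec A n) m) c →
                     lookup (transpose xss) c ≡ map (λ xs → lookup xs c) xss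
  lookup-transpose             []          c = lookup-replicate c []
  lookup-transpose {suc m} {n} (xs ∷ xss) c = begin
    lookup (replicate n cons ⊛ xs ⊛ transpose xss) c           ≡⟨ lookup-⊛ c (replicate n cons ⊛ xs) (transpose xss) ⟩
    lookup (replicate n cons ⊛ xs) c (lookup (transpose xss) c) ≡⟨ cong₂ _$_ head (lookup-transpose xss c) ⟩
    lookup xs c ∷ map (λ ys → lookup ys c) xss                   ∎
    where
    cons : A → Vec A m → Vec A (suc m)
    cons = _∷_
    head : lookup (replicate n cons ⊛ xs) c ≡ cons (lookup xs c)
    head = trans (lookup-⊛ c (replicate n cons) xs) (cong (_$ lookup xs c) (lookup-replicate c cons))

  columns-injective : ∀ {m n} (xss yss : Vec (Vec A n) m) →
    (∀ c → map (λ xs → lookup xs c) xss ≡ map (λ ys → lookup ys c) yss) → xss ≡ yss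
  columns-injective []         []         _    = refl
  columns-injective (xs ∷ xss) (ys ∷ yss) same = cong₂ _∷_
    (Pointwise-≡⇒≡ (ext λ c → ∷-injectiveˡ (same c)))
    (columns-injective xss yss (λ c → ∷-injectiveʳ (same c)))

  map-reverse-fixed : ∀ {m n} (xss : Vec (Vec A n) m) → All IsPal xss → map reverse xss ≡ xss
  map-reverse-fixed []         []         = refl
  map-reverse-fixed (xs ∷ xss) (p ∷ pal) = cong₂ _∷_ p (map-reverse-fixed xss pal)

  reverse-fixed : ∀ {m n} (xss : Vec (Vec A n) m) → All IsPal (transpose xss) → reverse xss ≡ xss
  reverse-fixed xss pal = columns-injective (reverse xss) xss λ c → begin
    map (λ xs → lookup xs c) (reverse xss) ≡⟨ map-reverse (λ xs → lookup xs c) xss ⟩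
    reverse (map (λ xs → lookup xs c) xss) ≡⟨ cong reverse (lookup-transpose xss c) ⟨
    reverse (lookup (transpose xss) c)     ≡⟨ lookup⁺ pal c ⟩
    lookup (transpose xss) c               ≡⟨ lookup-transpose xss c ⟩
    map (λ xs → lookup xs c) xss           ∎

Conjugate : ∀ {k m n} → Word k m n → Word k m n → Set
Conjugate w X = ∃₂ λ a b → X ≡ rotCol a (rotRow b w)

∈-conjList⁻ : ∀ {k m n} {w X : Word k m n} → X ∈ conjList w → Conjugate w X
∈-conjList⁻ {m = m} {n} {w} X∈ with satisfied (∈-concatMap⁻ row {upTo n} X∈)
  where
  row : ℕ → List (Word _ m n)
  row i = List.map (λ j → rotCol (suc i) (rotRow (suc j) w)) (upTo m)
... | i , X∈row with ∈-map⁻ (λ j → rotCol (suc i) (rotRow (suc j) w)) {xs = upTo m} X∈row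
...   | j , _ , X≡ = suc i , suc j , X≡

∈-hvpalConj⁻ : ∀ {k m n} {w X : Word k m n} → X ∈ hvpalConj w → Conjugate w X × IsHVPal X
∈-hvpalConj⁻ {w = w} X∈ with ∈-filter⁻ isHVPal? {xs = conjList w} (∈-deduplicate⁻ _≟W_ _ X∈)
... | X∈conj , hv = ∈-conjList⁻ X∈conj , hv

length-cartesianProductWith : ∀ {A B C : Set} (f : A → B → C) xs ys →
  length (cartesianProductWith f xs ys) ≡ length xs * length ys
length-cartesianProductWith f []       ys = refl
length-cartesianProductWith f (x ∷ xs) ys = begin
  length (List.map (f x) ys ++ cartesianProductWith f xs ys)         ≡⟨ length-++ (List.map (f x) ys) ⟩
  length (List.map (f x) ys) + length (cartesianProductWith f xs ys) ≡⟨ cong₂ _+_ (length-map (f x) ys)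
                                                                               (length-cartesianProductWith f xs ys) ⟩
  length ys + length xs * length ys                                  ∎

module _ {k m n : ℕ} where

  private
    W = Word k (suc m) (suc n)

  columnAction : CyclicAction W n
  columnAction = map-action rotR-action

  rowAction : CyclicAction W m
  rowAction = rotR-action

  private
    module C = CyclicAction columnAction
    module R = CyclicAction rowAction
    module RowHP (X : W) = HalfPeriods rowAction _≟W_ X
    module ColHP (X : W) = HalfPeriods columnAction _≟W_ X

  rotCol-rotRow : ∀ a b (X : W) → rotCol a (rotRow b X) ≡ rotRow b (rotCol a X)
  rotCol-rotRow a b X = map-rotR (rotR a) b X

  map-reverse-rotCol : ∀ a (X : W) → map reverse (rotCol a X) ≡ rotCol (a * n) (map reverse X)
  map-reverse-rotCol a X = begin
    map reverse (map (rotR a) X)           ≡⟨ map-∘ reverse (rotR a) X ⟨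
    map (λ v → reverse (rotR a v)) X       ≡⟨ map-cong (reverse-rotR a) X ⟩
    map (λ v → rotR (a * n) (reverse v)) X ≡⟨ map-∘ (rotR (a * n)) reverse X ⟩
    rotCol (a * n) (map reverse X)         ∎

  Conjugate-sym : ∀ {X Y : W} → Conjugate X Y → Conjugate Y X
  Conjugate-sym {X} (a , b , refl) = a * n , b * m , sym (begin
    rotCol (a * n) (rotRow (b * m) (rotCol a (rotRow b X))) ≡⟨ cong (rotCol (a * n)) (rotCol-rotRow a (b * m) _) ⟨
    rotCol (a * n) (rotCol a (rotRow (b * m) (rotRow b X))) ≡⟨ C.act-inverseˡ a _ ⟩
    rotRow (b * m) (rotRow b X)                             ≡⟨ R.act-inverseˡ b X ⟩
    X                                                       ∎)

  Conjugate-trans : ∀ {X Y Z : W} → Conjugate X Y → Conjugate Y Z → Conjugate X Z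
  Conjugate-trans {X} (a , b , refl) (c , d , refl) = c + a , d + b , (begin
    rotCol c (rotRow d (rotCol a (rotRow b X))) ≡⟨ cong (rotCol c) (rotCol-rotRow a d _) ⟨
    rotCol c (rotCol a (rotRow d (rotRow b X))) ≡⟨ C.act-+ c a _ ⟩
    rotCol (c + a) (rotRow d (rotRow b X))      ≡⟨ cong (rotCol (c + a)) (R.act-+ d b X) ⟩
    rotCol (c + a) (rotRow (d + b) X)           ∎)

  IsHVPal⇒flipH : ∀ {X : W} → IsHVPal X → map reverse X ≡ X
  IsHVPal⇒flipH (rows , _) = map-reverse-fixed _ rows

  IsHVPal⇒flipV : ∀ {X : W} → IsHVPal X → reverse X ≡ X
  IsHVPal⇒flipV (_ , columns) = reverse-fixed _ columns

  column-double-period : ∀ {X : W} p q → IsHVPal X → IsHVPal (rotCol p (rotRow q X)) →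
                         rotCol (p + p) X ≡ X
  column-double-period p q hvX hvY =
    symmetric-translate⇒double-period columnAction rowAction rotCol-rotRow
      (map reverse) map-reverse-rotCol (map-rotR reverse) p q (IsHVPal⇒flipH hvX) (IsHVPal⇒flipH hvY)

  row-double-period : ∀ {X : W} p q → IsHVPal X → IsHVPal (rotCol p (rotRow q X)) →
                      rotRow (q + q) X ≡ X
  row-double-period {X} p q hvX hvY =
    symmetric-translate⇒double-period rowAction columnAction (λ b a Y → sym (rotCol-rotRow a b Y))
      reverse reverse-rotR (λ a Y → sym (map-reverse (rotR a) Y)) q p (IsHVPal⇒flipV hvX)
      (subst (λ Y → reverse Y ≡ Y) (rotCol-rotRow p q X) (IsHVPal⇒flipV hvY))

  candidates : W → List W
  candidates X =
    cartesianProductWith (λ f e → rotCol e (rotRow f X)) (RowHP.halfPeriods X) (ColHP.halfPeriods X)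

  length-candidates : ∀ X → length (candidates X) ≡ parityBound (suc m) * parityBound (suc n)
  length-candidates X = trans (length-cartesianProductWith _ (RowHP.halfPeriods X) (ColHP.halfPeriods X))
                              (cong₂ _*_ (RowHP.length-halfPeriods X) (ColHP.length-halfPeriods X))

  hvpal-conjugate∈candidates : ∀ {X Y : W} → IsHVPal X → IsHVPal Y → Conjugate X Y → Y ∈ candidates X
  hvpal-conjugate∈candidates {X} hvX hvY (p , q , refl)
    with ColHP.halfPeriods-complete X p (column-double-period p q hvX hvY)
       | RowHP.halfPeriods-complete X q (row-double-period p q hvX hvY)
  ... | e , e∈ , col≡ | f , f∈ , row≡ =
    subst (_∈ candidates X) (sym Y≡) (∈-cartesianProductWith⁺ (λ f e → rotCol e (rotRow f X)) f∈ e∈)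
    where
    Y≡ : rotCol p (rotRow q X) ≡ rotCol e (rotRow f X)
    Y≡ = begin
      rotCol p (rotRow q X) ≡⟨ cong (rotCol p) row≡ ⟩
      rotCol p (rotRow f X) ≡⟨ rotCol-rotRow p f X ⟩
      rotRow f (rotCol p X) ≡⟨ cong (rotRow f) col≡ ⟩
      rotRow f (rotCol e X) ≡⟨ rotCol-rotRow e f X ⟨
      rotCol e (rotRow f X) ∎

module _ {A : Set} (_≟_ : DecidableEquality A) where

  private
    remove : A → List A → List A
    remove x []       = []
    remove x (y ∷ ys) with x ≟ y
    ... | yes _ = ys
    ... | no  _ = y ∷ remove x ys

    length-remove : ∀ {x} ys → x ∈ ys → length ys ≡ suc (length (remove x ys))
    length-remove {x} (y ∷ ys) x∈ with x ≟ y
    length-remove {x} (y ∷ ys) x∈          | yes _  = refl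
    length-remove {x} (y ∷ ys) (here refl) | no x≢y = contradiction refl x≢y
    length-remove {x} (y ∷ ys) (there x∈)  | no _   = cong suc (length-remove ys x∈)

    ∈-remove⁺ : ∀ {x z} ys → z ∈ ys → x ≢ z → z ∈ remove x ys
    ∈-remove⁺ {x} (y ∷ ys) z∈ x≢z with x ≟ y
    ∈-remove⁺ {x} (y ∷ ys) (here refl) x≢z | yes refl = contradiction refl x≢z
    ∈-remove⁺ {x} (y ∷ ys) (there z∈)  x≢z | yes refl = z∈
    ∈-remove⁺ {x} (y ∷ ys) (here refl) x≢z | no _     = here refl
    ∈-remove⁺ {x} (y ∷ ys) (there z∈)  x≢z | no _     = there (∈-remove⁺ ys z∈ x≢z)

  Unique-⊆⇒length-≤ : ∀ {xs ys : List A} → Unique xs → xs ⊆ ys → length xs ≤ length ys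
  Unique-⊆⇒length-≤ {[]}     {ys} _               _     = z≤n
  Unique-⊆⇒length-≤ {x ∷ xs} {ys} (x∉xs ∷ unique) xs⊆ys =
    subst (suc (length xs) ≤_) (sym (length-remove ys (xs⊆ys (here refl))))
      (s≤s (Unique-⊆⇒length-≤ unique
        (λ z∈ → ∈-remove⁺ ys (xs⊆ys (there z∈)) (ListAll.lookup x∉xs z∈))))

card-HVPALConj≤ : ∀ {k m n} (w : Word k m n) → card-HVPALConj w ≤ parityBound m * parityBound n
card-HVPALConj≤ {m = m}     {zero}  w = z≤n
card-HVPALConj≤ {m = zero}  {suc n} w =
  ≤-trans at-most-one (*-mono-≤ (1≤parityBound 0) (1≤parityBound (suc n)))
  where
  at-most-one : card-HVPALConj w ≤ 1
  at-most-one = Unique-⊆⇒length-≤ _≟W_ {ys = [] ∷ []}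
    (deduplicate-! _≟W_ (filter isHVPal? (conjList w))) λ { {[]} _ → here refl }
card-HVPALConj≤ {m = suc m} {suc n} w = bound (hvpalConj w) (deduplicate-! _≟W_ _) ∈-hvpalConj⁻
  where
  bound : ∀ Xs → Unique Xs → (∀ {X} → X ∈ Xs → Conjugate w X × IsHVPal X) →
          length Xs ≤ parityBound (suc m) * parityBound (suc n)
  bound []       _      _       = z≤n
  bound (X ∷ Xs) unique members = ≤-trans (Unique-⊆⇒length-≤ _≟W_ unique Xs⊆candidates)
                                          (≤-reflexive (length-candidates X))
    where
    Xs⊆candidates : X ∷ Xs ⊆ candidates X
    Xs⊆candidates Y∈ with members (here refl) | members Y∈
    ... | w~X , hvX | w~Y , hvY =
      hvpal-conjugate∈candidates hvX hvY (Conjugate-trans (Conjugate-sym w~X) w~Y)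

corollary4p9 : ∀ {k m n : ℕ} (w : Word k m n) →
    ((2 ∣ m) × (2 ∣ n) → card-HVPALConj w ≤ 4)
    × ((¬ (2 ∣ m)) × (¬ (2 ∣ n)) → card-HVPALConj w ≤ 1)
    × (((2 ∣ m) × (¬ (2 ∣ n))) ⊎ ((¬ (2 ∣ m)) × (2 ∣ n)) → card-HVPALConj w ≤ 2)
corollary4p9 {m = m} {n} w =
    (λ (2∣m , 2∣n) → bounded (parityBound-even 2∣m) (parityBound-even 2∣n))
  , (λ (m-odd , n-odd) → bounded (parityBound-odd m-odd) (parityBound-odd n-odd))
  , λ { (inj₁ (2∣m , n-odd)) → bounded (parityBound-even 2∣m) (parityBound-odd n-odd)
      ; (inj₂ (m-odd , 2∣n)) → bounded (parityBound-odd m-odd) (parityBound-even 2∣n) }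
  where
  bounded : ∀ {a b} → parityBound m ≡ a → parityBound n ≡ b → card-HVPALConj w ≤ a * b
  bounded refl refl = card-HVPALConj≤ w
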